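{- Let $(G,\sigma)$ be a connected bipartite graph, with $\sigma$ the vertex 2-coloring given by the bipartition, and $1<|V(G)|<6$. Then $G$ is a un2qBMG explained by the tree $(T,\sigma,u)$ (with root $\rho$) in each of the following cases: (I) $|V(G)|\in\{2,3\}$, or $|V(G)|\in\{4,5\}$ and $G$ is complete bipartite: $T$ is the star tree with leaf set $V(G)$ and $u(x)=\rho$ for all $x$. (II) $|V(G)|=4$ and $G$ is the path $x_1x_2x_3x_4$: $\rho$ has children $x_1,x_2,w$, and $w$ has children $x_3,x_4$; $u(x_1)=x_1$ and $u(x_i)=\rho$ for $2\le i\le 4$. (III) $|V(G)|=5$, $V(G)=\{x_1,\dots,x_5\}$, and (1) $E(G)=\{x_1x_2,x_2x_3,x_3x_4,x_4x_5\}$: $\rho$ has children $w_1,x_3,w_2$, $w_1$ has children $x_1,x_2$, $w_2$ has children $x_4,x_5$; $u(x_i)=\rho$ for all $i$; (2) $E(G)=\{x_1x_4,x_2x_3,x_3x_4,x_4x_5\}$: $\rho$ has children $x_1,w,x_4,x_5$, and $w$ has children $x_2,x_3$; $u(x_1)=x_1$, $u(x_5)=x_5$, $u(x_i)=\rho$ for $2\le i\le 4$; (3) $E(G)=\{x_1x_2,x_1x_4,x_2x_3,x_3x_4,x_4x_5\}$: $\rho$ has children $w,x_4,x_5$, and $w$ has children $x_1,x_2,x_3$; $u(x_5)=x_5$ and $u(x_i)=\rho$ for $1\le i\le 4$.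
   Context: A un2qBMG is the underlying undirected graph of a 2-colored quasi-best match graph; equivalently, a vertex-colored graph explained by a tree in the following sense. $a\preceq b$ means $a$ is a descendant of or equal to $b$ in a rooted tree; $\mathrm{lca}$ is the last common ancestor. A tree $(T,\sigma,u)$ with $\sigma$ a leaf-coloring into two colors and $u(x)\in\{x,\rho\}$ for each leaf $x$ explains $(G,\sigma)$ if $V(G)=L(T)$ and for leaves $x,y$: $xy\in E(G)$ iff $\sigma(x)\neq\sigma(y)$ and either (a) $u(x)\neq x$ and $y\preceq\mathrm{lca}(x,z)$ for all leaves $z$ with $\sigma(z)=\sigma(y)$, or (b) $u(y)\neq y$ and $x\preceq\mathrm{lca}(y,z)$ for all leaves $z$ with $\sigma(z)=\sigma(x)$. -}

module Defs where

open import Data.Nat using (ℕ)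
open import Data.Fin using (Fin; #_)
open import Data.Bool using (Bool)
open import Data.List using (List; []; _∷_; _++_; map; allFin)
open import Data.List.Membership.Propositional using (_∈_)
open import Data.List.Relation.Binary.Permutation.Propositional using (_↭_)
open import Data.Product using (_×_; _,_)
open import Data.Sum using (_⊎_)
open import Relation.Nullary using (¬_)
open import Relation.Binary.PropositionalEquality using (_≡_; _≢_)
open import Relation.Binary.Construct.Closure.ReflexiveTransitive using (Star)
open import Function.Bundles using (_⇔_)

Symmetric : ∀ {n} → (Fin n → Fin n → Set) → Set
Symmetric {n} E = ∀ {x y : Fin n} → E x y → E y x

ProperColoring : ∀ {n} → (Fin n → Fin n → Set) → (Fin n → Bool) → Set
ProperColoring {n} E σ = ∀ (x y : Fin n) → E x y → σ x ≢ σ y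

Connected : ∀ {n} → (Fin n → Fin n → Set) → Set
Connected {n} E = ∀ (x y : Fin n) → Star E x y

CompleteBipartite : ∀ {n} → (Fin n → Fin n → Set) → (Fin n → Bool) → Set
CompleteBipartite {n} E σ = ∀ (x y : Fin n) → (E x y ⇔ (σ x ≢ σ y))

Edge : ∀ {n} → List (Fin n × Fin n) → Fin n → Fin n → Set
Edge es x y = ((x , y) ∈ es) ⊎ ((y , x) ∈ es)

-- Rooted trees with leaves labelled by Fin n (the root is the whole tree).

data Tree (n : ℕ) : Set where
  leaf : Fin n → Tree n
  node : List (Tree n) → Tree n

mutual
  leaves : ∀ {n} → Tree n → List (Fin n)
  leaves (leaf x) = x ∷ []
  leaves (node ts) = leavesL ts

  leavesL : ∀ {n} → List (Tree n) → List (Fin n)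
  leavesL [] = []
  leavesL (t ∷ ts) = leaves t ++ leavesL ts

data _∈L_ {n : ℕ} (x : Fin n) : Tree n → Set where
  here  : x ∈L leaf x
  there : ∀ {ts t} → t ∈ ts → x ∈L t → x ∈L node ts

data _≤T_ {n : ℕ} : Tree n → Tree n → Set where
  refl≤ : ∀ {t} → t ≤T t
  step  : ∀ {s t ts} → t ∈ ts → s ≤T t → s ≤T node ts

IsLca : ∀ {n} → Tree n → Fin n → Fin n → Tree n → Set
IsLca T x z v =
  (v ≤T T) × (x ∈L v) × (z ∈L v) ×
  (∀ {ts c} → v ≡ node ts → c ∈ ts → ¬ ((x ∈L c) × (z ∈L c)))

BelowLca : ∀ {n} → Tree n → Fin n → Fin n → Fin n → Set
BelowLca T y x z = ∀ v → IsLca T x z v → y ∈L v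

-- values of u : u(x) = x  ("self")  or  u(x) = ρ  ("root")
data U : Set where
  self root : U

CondA : ∀ {n} → Tree n → (Fin n → Bool) → (Fin n → U) → Fin n → Fin n → Set
CondA {n} T σ u x y =
  (u x ≡ root) × (∀ (z : Fin n) → σ z ≡ σ y → BelowLca T y x z)

Explains : ∀ {n} → Tree n → (Fin n → Bool) → (Fin n → U) → (Fin n → Fin n → Set) → Set
Explains {n} T σ u E =
  (leaves T ↭ allFin n) ×
  (∀ (x y : Fin n) →
     (E x y ⇔ ((σ x ≢ σ y) × (CondA T σ u x y ⊎ CondA T σ u y x))))

-- The concrete graphs / trees of the proposition.  Vertex x_i is  # (i - 1).

star : (n : ℕ) → Tree n
star n = node (map leaf (allFin n))

path4 : List (Fin 4 × Fin 4)
path4 = (# 0 , # 1) ∷ (# 1 , # 2) ∷ (# 2 , # 3) ∷ []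

tree-II : Tree 4
tree-II = node (leaf (# 0) ∷ leaf (# 1) ∷ node (leaf (# 2) ∷ leaf (# 3) ∷ []) ∷ [])

u-II : Fin 4 → U
u-II x with Data.Fin.toℕ x
... | 0 = self
... | _ = root

edges-III1 : List (Fin 5 × Fin 5)
edges-III1 = (# 0 , # 1) ∷ (# 1 , # 2) ∷ (# 2 , # 3) ∷ (# 3 , # 4) ∷ []

tree-III1 : Tree 5
tree-III1 = node (node (leaf (# 0) ∷ leaf (# 1) ∷ []) ∷ leaf (# 2)
                  ∷ node (leaf (# 3) ∷ leaf (# 4) ∷ []) ∷ [])

u-III1 : Fin 5 → U
u-III1 _ = root

edges-III2 : List (Fin 5 × Fin 5)
edges-III2 = (# 0 , # 3) ∷ (# 1 , # 2) ∷ (# 2 , # 3) ∷ (# 3 , # 4) ∷ []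

tree-III2 : Tree 5
tree-III2 = node (leaf (# 0) ∷ node (leaf (# 1) ∷ leaf (# 2) ∷ []) ∷ leaf (# 3) ∷ leaf (# 4) ∷ [])

u-III2 : Fin 5 → U
u-III2 x with Data.Fin.toℕ x
... | 0 = self
... | 4 = self
... | _ = root

edges-III3 : List (Fin 5 × Fin 5)
edges-III3 = (# 0 , # 1) ∷ (# 0 , # 3) ∷ (# 1 , # 2) ∷ (# 2 , # 3) ∷ (# 3 , # 4) ∷ []

tree-III3 : Tree 5
tree-III3 = node (node (leaf (# 0) ∷ leaf (# 1) ∷ leaf (# 2) ∷ []) ∷ leaf (# 3) ∷ leaf (# 4) ∷ [])

u-III3 : Fin 5 → U
u-III3 x with Data.Fin.toℕ x
... | 4 = self
... | _ = root

-- Once the tree and the graph are fixed, whether the tree explains the graph under a colouring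
-- is decidable and depends only on the colouring pointwise, so cases (II) and (III) are settled
-- by running a decision procedure over all 2^n colourings. In the star the lca of two leaves of
-- different colours is the root, so the star with u ≡ ρ explains exactly the complete bipartite
-- graphs; a connected bipartite graph on at most three vertices is complete bipartite because
-- one of its two colour classes is a single vertex.
module Submission where

open import Defs
open import Data.Nat using (ℕ; zero; suc; _≤_; _<_; z≤n; s≤s)
open import Data.Fin using (Fin; _≟_) renaming (zero to fzero; suc to fsuc)
open import Data.Fin.Properties using (all?)
open import Data.Bool using (Bool; true; false)
open import Data.Bool.Properties using (¬-not) renaming (_≟_ to _≟ᴮ_)
open import Data.Vec.Functional using (tail) renaming (_∷_ to _◂_)
open import Data.Product using (_×_; _,_; ∃; proj₁)
open import Data.Product.Properties using (≡-dec)
open import Data.Sum using (_⊎_; inj₁; inj₂; [_,_]) renaming (map to map⊎)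
open import Data.Empty using (⊥-elim)
open import Data.List using (List; []; _∷_; _++_; map; allFin)
open import Data.List.Membership.Propositional using (_∈_; find; lose)
open import Data.List.Membership.Propositional.Properties using (∈-++⁻; ∈-++⁺ˡ; ∈-++⁺ʳ; ∈-map⁻; ∈-map⁺; ∈-allFin)
import Data.List.Membership.DecPropositional as DecMembership
open import Data.List.Relation.Unary.Any as Any using (Any)
import Data.List.Relation.Unary.All as All
open import Data.List.Relation.Binary.Permutation.Propositional using (_↭_; ↭-refl; ↭-reflexive)
open import Function using (_∘_; const)
open import Function.Bundles using (_⇔_; mk⇔; Equivalence)
open import Relation.Nullary using (¬_; Dec; yes; no; ¬?)
open import Relation.Nullary.Decidable using (map′; _×-dec_; _⊎-dec_; _→-dec_; toWitness; True)
open import Relation.Binary.PropositionalEquality using (_≡_; _≢_; _≗_; refl; sym; trans; cong; subst)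
open import Relation.Binary.Construct.Closure.ReflexiveTransitive using (ε; _◅_)

open Equivalence using (to; from)

_⇔?_ : ∀ {A B : Set} → Dec A → Dec B → Dec (A ⇔ B)
yes a ⇔? yes b = yes (mk⇔ (const b) (const a))
yes a ⇔? no ¬b = no λ a⇔b → ¬b (to a⇔b a)
no ¬a ⇔? yes b = no λ a⇔b → ¬a (from a⇔b b)
no ¬a ⇔? no ¬b = yes (mk⇔ (⊥-elim ∘ ¬a) (⊥-elim ∘ ¬b))

∈L-leaf⁻ : ∀ {n} {x a : Fin n} → x ∈L leaf a → x ≡ a
∈L-leaf⁻ here = refl

mutual
  _∈L?_ : ∀ {n} (x : Fin n) (t : Tree n) → Dec (x ∈L t)
  x ∈L? leaf a = map′ (λ { refl → here }) ∈L-leaf⁻ (x ≟ a)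
  x ∈L? node ts =
    map′ (λ p → let _ , t∈ts , x∈t = find p in there t∈ts x∈t)
         (λ { (there t∈ts x∈t) → lose t∈ts x∈t })
         (x ∈L-any? ts)

  _∈L-any?_ : ∀ {n} (x : Fin n) (ts : List (Tree n)) → Dec (Any (x ∈L_) ts)
  x ∈L-any? [] = no λ ()
  x ∈L-any? (t ∷ ts) = map′ Any.fromSum Any.toSum ((x ∈L? t) ⊎-dec (x ∈L-any? ts))

mutual
  subtrees : ∀ {n} → Tree n → List (Tree n)
  subtrees (leaf x) = leaf x ∷ []
  subtrees (node ts) = node ts ∷ subtreesL ts

  subtreesL : ∀ {n} → List (Tree n) → List (Tree n)
  subtreesL [] = []
  subtreesL (t ∷ ts) = subtrees t ++ subtreesL ts

mutual
  ∈-subtrees⁻ : ∀ {n} {v : Tree n} (T : Tree n) → v ∈ subtrees T → v ≤T T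
  ∈-subtrees⁻ (leaf x) (Any.here refl) = refl≤
  ∈-subtrees⁻ (node ts) (Any.here refl) = refl≤
  ∈-subtrees⁻ (node ts) (Any.there v∈) with ∈-subtreesL⁻ ts v∈
  ... | t , t∈ts , v≤t = step t∈ts v≤t

  ∈-subtreesL⁻ : ∀ {n} {v : Tree n} (ts : List (Tree n)) → v ∈ subtreesL ts →
                 ∃ λ t → t ∈ ts × v ≤T t
  ∈-subtreesL⁻ (t ∷ ts) v∈ with ∈-++⁻ (subtrees t) v∈
  ... | inj₁ v∈t = t , Any.here refl , ∈-subtrees⁻ t v∈t
  ... | inj₂ v∈ts with ∈-subtreesL⁻ ts v∈ts
  ...   | t′ , t′∈ts , v≤t′ = t′ , Any.there t′∈ts , v≤t′

∈-subtrees-refl : ∀ {n} (T : Tree n) → T ∈ subtrees T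
∈-subtrees-refl (leaf x) = Any.here refl
∈-subtrees-refl (node ts) = Any.here refl

∈-subtreesL⁺ : ∀ {n} {s t : Tree n} {ts} → t ∈ ts → s ∈ subtrees t → s ∈ subtreesL ts
∈-subtreesL⁺ {ts = t ∷ ts} (Any.here refl) s∈ = ∈-++⁺ˡ s∈
∈-subtreesL⁺ {ts = t ∷ ts} (Any.there t∈ts) s∈ = ∈-++⁺ʳ (subtrees t) (∈-subtreesL⁺ t∈ts s∈)

∈-subtrees⁺ : ∀ {n} {v T : Tree n} → v ≤T T → v ∈ subtrees T
∈-subtrees⁺ {T = T} refl≤ = ∈-subtrees-refl T
∈-subtrees⁺ (step t∈ts v≤t) = Any.there (∈-subtreesL⁺ t∈ts (∈-subtrees⁺ v≤t))

NoChildContainsBoth : ∀ {n} → Fin n → Fin n → Tree n → Set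
NoChildContainsBoth x z v = ∀ {ts c} → v ≡ node ts → c ∈ ts → ¬ ((x ∈L c) × (z ∈L c))

RootIsLca : ∀ {n} → Fin n → Fin n → Tree n → Set
RootIsLca x z v = (x ∈L v) × (z ∈L v) × NoChildContainsBoth x z v

NoChildContainsBoth? : ∀ {n} (x z : Fin n) (v : Tree n) → Dec (NoChildContainsBoth x z v)
NoChildContainsBoth? x z (leaf a) = yes λ ()
NoChildContainsBoth? x z (node ts) =
  map′ (λ { none refl c∈ts → All.lookup none c∈ts }) (λ none → All.tabulate (none refl))
       (All.all? (λ c → ¬? ((x ∈L? c) ×-dec (z ∈L? c))) ts)

RootIsLca? : ∀ {n} (x z : Fin n) (v : Tree n) → Dec (RootIsLca x z v)
RootIsLca? x z v = (x ∈L? v) ×-dec (z ∈L? v) ×-dec NoChildContainsBoth? x z v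

BelowLca? : ∀ {n} (T : Tree n) (y x z : Fin n) → Dec (BelowLca T y x z)
BelowLca? T y x z =
  map′ (λ below v (v≤T , lca) → All.lookup below (∈-subtrees⁺ v≤T) lca)
       (λ below → All.tabulate λ {v} v∈ lca → below v (∈-subtrees⁻ T v∈ , lca))
       (All.all? (λ v → RootIsLca? x z v →-dec (y ∈L? v)) (subtrees T))

≡root? : (a : U) → Dec (a ≡ root)
≡root? self = no λ ()
≡root? root = yes refl

CondA? : ∀ {n} (T : Tree n) σ u (x y : Fin n) → Dec (CondA T σ u x y)
CondA? T σ u x y = ≡root? (u x) ×-dec all? (λ z → (σ z ≟ᴮ σ y) →-dec BelowLca? T y x z)

ExplainsEdges : ∀ {n} → Tree n → (Fin n → Bool) → (Fin n → U) → (Fin n → Fin n → Set) → Set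
ExplainsEdges T σ u E =
  ∀ x y → E x y ⇔ ((σ x ≢ σ y) × (CondA T σ u x y ⊎ CondA T σ u y x))

Edge? : ∀ {n} (es : List (Fin n × Fin n)) (x y : Fin n) → Dec (Edge es x y)
Edge? es x y = ((x , y) ∈? es) ⊎-dec ((y , x) ∈? es)
  where open DecMembership (≡-dec _≟_ _≟_) using (_∈?_)

ExplainsEdges? : ∀ {n} (T : Tree n) σ u (es : List (Fin n × Fin n)) →
                 Dec (ExplainsEdges T σ u (Edge es))
ExplainsEdges? T σ u es = all? λ x → all? λ y →
  Edge? es x y ⇔? (¬? (σ x ≟ᴮ σ y) ×-dec (CondA? T σ u x y ⊎-dec CondA? T σ u y x))

ProperColoring? : ∀ {n} (es : List (Fin n × Fin n)) σ → Dec (ProperColoring (Edge es) σ)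
ProperColoring? es σ = all? λ x → all? λ y → Edge? es x y →-dec ¬? (σ x ≟ᴮ σ y)

ColouringInvariant : ∀ {n} → ((Fin n → Bool) → Set) → Set
ColouringInvariant P = ∀ {σ τ} → σ ≗ τ → P σ → P τ

∀-colouring? : ∀ {n} {P : (Fin n → Bool) → Set} →
               ColouringInvariant P → (∀ σ → Dec (P σ)) → Dec (∀ σ → P σ)
∀-colouring? {zero} inv P? = map′ (λ p σ → inv (λ ()) p) (λ all → all empty) (P? empty)
  where
  empty : Fin 0 → Bool
  empty ()
∀-colouring? {suc n} {P} inv P? =
  map′ (λ (all-true , all-false) σ → inv (sym ∘ head∷tail σ) (extend all-true all-false (σ fzero) (tail σ)))
       (λ all → all ∘ (true ◂_) , all ∘ (false ◂_))
       (by-head true ×-dec by-head false)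
  where
  ∷-cong : ∀ b {τ τ′ : Fin n → Bool} → τ ≗ τ′ → (b ◂ τ) ≗ (b ◂ τ′)
  ∷-cong b eq fzero = refl
  ∷-cong b eq (fsuc i) = eq i

  head∷tail : (σ : Fin (suc n) → Bool) → σ ≗ (σ fzero ◂ tail σ)
  head∷tail σ fzero = refl
  head∷tail σ (fsuc i) = refl

  by-head : ∀ b → Dec (∀ τ → P (b ◂ τ))
  by-head b = ∀-colouring? (inv ∘ ∷-cong b) (P? ∘ (b ◂_))

  extend : (∀ τ → P (true ◂ τ)) → (∀ τ → P (false ◂ τ)) → ∀ b τ → P (b ◂ τ)
  extend all-true all-false true = all-true
  extend all-true all-false false = all-false

≗-sym : ∀ {n} {σ τ : Fin n → Bool} → σ ≗ τ → τ ≗ σ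
≗-sym σ≗τ = sym ∘ σ≗τ

same-colour-resp : ∀ {n} {σ τ : Fin n → Bool} {x y} → σ ≗ τ → σ x ≡ σ y → τ x ≡ τ y
same-colour-resp {x = x} {y} σ≗τ eq = trans (sym (σ≗τ x)) (trans eq (σ≗τ y))

ProperColoring-resp : ∀ {n} {E : Fin n → Fin n → Set} → ColouringInvariant (ProperColoring E)
ProperColoring-resp σ≗τ proper x y xy = proper x y xy ∘ same-colour-resp (≗-sym σ≗τ)

CondA-resp : ∀ {n} {T : Tree n} {u x y} → ColouringInvariant (λ σ → CondA T σ u x y)
CondA-resp σ≗τ (ux≡root , below) = ux≡root , λ z → below z ∘ same-colour-resp (≗-sym σ≗τ)

ExplainsEdges-resp : ∀ {n} {T : Tree n} {u E} → ColouringInvariant (λ σ → ExplainsEdges T σ u E)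
ExplainsEdges-resp {T = T} {u} σ≗τ explains x y = mk⇔
  (λ xy → let ne , cond = to (explains x y) xy in
    ne ∘ same-colour-resp (≗-sym σ≗τ) , map⊎ (resp σ≗τ) (resp σ≗τ) cond)
  (λ (ne , cond) → from (explains x y)
    (ne ∘ same-colour-resp σ≗τ , map⊎ (resp (≗-sym σ≗τ)) (resp (≗-sym σ≗τ)) cond))
  where
  resp : ∀ {σ τ a b} → σ ≗ τ → CondA T σ u a b → CondA T τ u a b
  resp = CondA-resp {T = T} {u}

ExplainsIfProper : ∀ {n} → Tree n → (Fin n → U) → List (Fin n × Fin n) → (Fin n → Bool) → Set
ExplainsIfProper T u es σ = ProperColoring (Edge es) σ → ExplainsEdges T σ u (Edge es)

explains-if-proper? : ∀ {n} (T : Tree n) u es → Dec (∀ σ → ExplainsIfProper T u es σ)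
explains-if-proper? T u es =
  ∀-colouring? (λ σ≗τ explains → ExplainsEdges-resp σ≗τ ∘ explains ∘ ProperColoring-resp (≗-sym σ≗τ))
               (λ σ → ProperColoring? es σ →-dec ExplainsEdges? T σ u es)

explains-by-decision :
  ∀ {n} (T : Tree n) u es → leaves T ↭ allFin n → True (explains-if-proper? T u es) →
  ∀ σ → ProperColoring (Edge es) σ → Explains T σ u (Edge es)
explains-by-decision T u es leaves↭ decided σ proper =
  leaves↭ , toWitness {a? = explains-if-proper? T u es} decided σ proper

leavesL-map-leaf : ∀ {n} (xs : List (Fin n)) → leavesL (map leaf xs) ≡ xs
leavesL-map-leaf [] = refl
leavesL-map-leaf (x ∷ xs) = cong (x ∷_) (leavesL-map-leaf xs)

∈L-star : ∀ {n} (y : Fin n) → y ∈L star n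
∈L-star y = there (∈-map⁺ leaf (∈-allFin y)) here

star-subtree : ∀ {n} {v : Tree n} → v ≤T star n → v ≡ star n ⊎ ∃ λ a → v ≡ leaf a
star-subtree refl≤ = inj₁ refl
star-subtree (step t∈ts v≤t) with ∈-map⁻ leaf t∈ts
... | a , _ , refl with v≤t
...   | refl≤ = inj₂ (a , refl)

-- Leaves of different colours are distinct, so their lca is not a leaf, hence it is the root.
star-condA : ∀ {n} {σ : Fin n → Bool} {x y} → σ x ≢ σ y → CondA (star n) σ (const root) x y
star-condA {σ = σ} {x} {y} σx≢σy = refl , λ z σz≡σy v (v≤T , x∈v , z∈v , _) → lca-contains v≤T x∈v z∈v σz≡σy
  where
  lca-contains : ∀ {v z} → v ≤T star _ → x ∈L v → z ∈L v → σ z ≡ σ y → y ∈L v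
  lca-contains v≤T x∈v z∈v σz≡σy with star-subtree v≤T
  ... | inj₁ refl = ∈L-star y
  ... | inj₂ (a , refl) = ⊥-elim (σx≢σy (trans (cong σ (trans (∈L-leaf⁻ x∈v) (sym (∈L-leaf⁻ z∈v)))) σz≡σy))

star-explains : ∀ {n} {E : Fin n → Fin n → Set} {σ : Fin n → Bool} →
                CompleteBipartite E σ → Explains (star n) σ (const root) E
star-explains {n} complete =
  ↭-reflexive (leavesL-map-leaf (allFin n)) ,
  λ x y → mk⇔ (λ xy → let σx≢σy = to (complete x y) xy in σx≢σy , inj₁ (star-condA σx≢σy))
              (from (complete x y) ∘ proj₁)

OnlyOfItsColour : ∀ {n} → (Fin n → Bool) → Fin n → Set
OnlyOfItsColour σ x = ∀ a → σ a ≡ σ x → a ≡ x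

OnlyOfItsColour? : ∀ {n} (σ : Fin n → Bool) x → Dec (OnlyOfItsColour σ x)
OnlyOfItsColour? σ x = all? λ a → (σ a ≟ᴮ σ x) →-dec (a ≟ x)

OnlyOfItsColour-resp : ∀ {n} {x : Fin n} → ColouringInvariant (λ σ → OnlyOfItsColour σ x)
OnlyOfItsColour-resp σ≗τ only a = only a ∘ same-colour-resp (≗-sym σ≗τ)

SomeColourClassIsSingleton : ℕ → Set
SomeColourClassIsSingleton n =
  ∀ (σ : Fin n → Bool) x y → σ x ≢ σ y → OnlyOfItsColour σ x ⊎ OnlyOfItsColour σ y

some-colour-class-is-singleton? : ∀ n → Dec (SomeColourClassIsSingleton n)
some-colour-class-is-singleton? n = ∀-colouring? invariant λ σ → all? λ x → all? λ y →
  ¬? (σ x ≟ᴮ σ y) →-dec (OnlyOfItsColour? σ x ⊎-dec OnlyOfItsColour? σ y)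
  where
  invariant : ColouringInvariant λ σ → ∀ x y → σ x ≢ σ y → OnlyOfItsColour σ x ⊎ OnlyOfItsColour σ y
  invariant σ≗τ singleton x y τx≢τy =
    map⊎ (OnlyOfItsColour-resp σ≗τ) (OnlyOfItsColour-resp σ≗τ) (singleton x y (τx≢τy ∘ same-colour-resp σ≗τ))

≤3⇒some-colour-class-is-singleton : ∀ {n} → n ≤ 3 → SomeColourClassIsSingleton n
≤3⇒some-colour-class-is-singleton z≤n = toWitness {a? = some-colour-class-is-singleton? 0} _
≤3⇒some-colour-class-is-singleton (s≤s z≤n) = toWitness {a? = some-colour-class-is-singleton? 1} _
≤3⇒some-colour-class-is-singleton (s≤s (s≤s z≤n)) = toWitness {a? = some-colour-class-is-singleton? 2} _
≤3⇒some-colour-class-is-singleton (s≤s (s≤s (s≤s z≤n))) = toWitness {a? = some-colour-class-is-singleton? 3} _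

-- The first step of a path from x leads to the other colour class, which is just y.
adjacent-to-only-of-its-colour : ∀ {n} {E : Fin n → Fin n → Set} {σ x y} →
  Connected E → ProperColoring E σ → σ x ≢ σ y → OnlyOfItsColour σ y → E x y
adjacent-to-only-of-its-colour {E = E} {σ} {x} {y} connected proper σx≢σy only with connected x y
... | ε = ⊥-elim (σx≢σy refl)
... | _◅_ {j = a} xa _ = subst (E x) (only a σa≡σy) xa
  where
  σa≡σy : σ a ≡ σ y
  σa≡σy = trans (¬-not (proper x a xa ∘ sym)) (sym (¬-not (σx≢σy ∘ sym)))

≤3-connected-bipartite⇒complete : ∀ {n} {E : Fin n → Fin n → Set} {σ} → n ≤ 3 →
  Symmetric E → ProperColoring E σ → Connected E → CompleteBipartite E σ
≤3-connected-bipartite⇒complete n≤3 symmetric proper connected x y = mk⇔ (proper x y) λ σx≢σy →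
  [ (λ only-x → symmetric (adjacent-to-only-of-its-colour connected proper (σx≢σy ∘ sym) only-x))
  , adjacent-to-only-of-its-colour connected proper σx≢σy
  ] (≤3⇒some-colour-class-is-singleton n≤3 _ x y σx≢σy)

proposition4p2 :
    ((n : ℕ) → 2 ≤ n → n < 6 →
      (E : Fin n → Fin n → Set) → (σ : Fin n → Bool) →
      Symmetric E → ProperColoring E σ → Connected E →
      (n ≤ 3 ⊎ CompleteBipartite E σ) →
      Explains (star n) σ (λ _ → root) E)
    ×
    ((σ : Fin 4 → Bool) → ProperColoring (Edge path4) σ →
      Explains tree-II σ u-II (Edge path4))
    ×
    ((σ : Fin 5 → Bool) → ProperColoring (Edge edges-III1) σ →
      Explains tree-III1 σ u-III1 (Edge edges-III1))
    ×
    ((σ : Fin 5 → Bool) → ProperColoring (Edge edges-III2) σ →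
      Explains tree-III2 σ u-III2 (Edge edges-III2))
    ×
    ((σ : Fin 5 → Bool) → ProperColoring (Edge edges-III3) σ →
      Explains tree-III3 σ u-III3 (Edge edges-III3))
proposition4p2 =
  case-I ,
  explains-by-decision tree-II u-II path4 ↭-refl _ ,
  explains-by-decision tree-III1 u-III1 edges-III1 ↭-refl _ ,
  explains-by-decision tree-III2 u-III2 edges-III2 ↭-refl _ ,
  explains-by-decision tree-III3 u-III3 edges-III3 ↭-refl _
  where
  case-I : ∀ n → 2 ≤ n → n < 6 → ∀ E σ → Symmetric E → ProperColoring E σ → Connected E →
           (n ≤ 3 ⊎ CompleteBipartite E σ) → Explains (star n) σ (λ _ → root) E
  case-I _ _ _ _ _ symmetric proper connected (inj₁ n≤3) =
    star-explains (≤3-connected-bipartite⇒complete n≤3 symmetric proper connected)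
  case-I _ _ _ _ _ _ _ _ (inj₂ complete) = star-explains complete
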